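{- Let $F$ be an $r$-uniform hypergraph such that for every hyperedge of $F$ there is another hyperedge of $F$ sharing at least $t$ vertices with it, and let $k\geq t$ with $k>r$. Then $\mathrm{sat}_k(n,\text{Berge- }F)=\Omega(n^t)$.
   Context: For an $r$-uniform hypergraph $F$ and $k>r$, a $k$-uniform hypergraph $H$ is Berge-$F$ if there is a bijection $\phi:E(F)\to E(H)$ with $e\subseteq\phi(e)$ for all $e\in E(F)$ (with $V(F)$ identified with a subset of $V(H)$); $H$ contains a Berge-$F$ if some subhypergraph is Berge-$F$. A $k$-uniform hypergraph on $n$ vertices is Berge-$F$-saturated if it contains no Berge-$F$ but adding any new $k$-edge creates one; $\mathrm{sat}_k(n,\text{Berge- }F)$ is the minimum number of hyperedges in such a hypergraph. -}

module Defs where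

open import Data.Nat using (ℕ; suc; _≤_; _<_; _*_; _^_)
open import Data.Fin using (Fin; zero; suc)
open import Data.Fin.Subset using (Subset; _∈_; ∣_∣; _∩_)
open import Data.Product using (Σ; ∃-syntax; _×_)
open import Relation.Binary.PropositionalEquality using (_≡_; _≢_)
open import Relation.Nullary using (¬_)
open import Function.Definitions using (Injective)

-- A (multi-)hypergraph on vertex set Fin n with m hyperedges is an edge
-- function Fin m → Subset n; "simple" hypergraphs additionally have an
-- injective edge function (no repeated hyperedges).

Uniform : ∀ {n m} → ℕ → (Fin m → Subset n) → Set
Uniform k E = ∀ i → ∣ E i ∣ ≡ k

-- H (edges E on Fin n) contains a Berge copy of F (edges G on Fin v):
-- an injective vertex embedding f : Fin v → Fin n and an injective map
-- φ from edges of F to edges of H with f(e) ⊆ φ(e) for every edge e of F.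
-- (An injection into E(H) is the same as a bijection onto the edge set of
-- a subhypergraph of H.)
ContainsBerge : ∀ {v a n m} → (Fin a → Subset v) → (Fin m → Subset n) → Set
ContainsBerge {v} {a} {n} {m} G E =
  Σ (Fin v → Fin n) λ f → Σ (Fin a → Fin m) λ φ →
    Injective _≡_ _≡_ f × Injective _≡_ _≡_ φ ×
    (∀ e x → x ∈ G e → f x ∈ E (φ e))

addEdge : ∀ {n m} → (Fin m → Subset n) → Subset n → Fin (suc m) → Subset n
addEdge E S zero    = S
addEdge E S (suc i) = E i

BergeSaturated : ∀ {v a n m} → ℕ → (Fin a → Subset v) → (Fin m → Subset n) → Set
BergeSaturated k G E =
  ¬ ContainsBerge G E ×
  (∀ S → ∣ S ∣ ≡ k → (∀ i → E i ≢ S) → ContainsBerge G (addEdge E S))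

-- In a Berge-F-saturated k-graph H every k-set S meets some hyperedge in at least t
-- vertices: either S is a hyperedge, or H + S contains a Berge-F, which must use S for
-- some edge e of F (H itself has none); an edge e′ of F sharing t vertices with e is
-- sent to an old hyperedge E i, and the vertex embedding maps G e ∩ G e′ into S ∩ E i.
-- Split the vertices into k blocks of q = ⌊n/k⌋ and consider the q ^ k transversals.
-- A fixed k-set meets at most 2 ^ k k ^ t q ^ (k ∸ t) of them in t or more vertices, so
-- covering all transversals needs m ≥ q ^ t / (2 ^ k k ^ t) hyperedges, and q ≥ n / 2k.

module Submission where

open import Defs
open import Data.Nat.Base using (ℕ; zero; suc; _+_; _*_; _^_; _≤_; _<_; z≤n; s≤s; NonZero; >-nonZero)
open import Data.Nat.Properties
open import Data.Nat.DivMod using (_/_; _%_; m≡m%n+[m/n]*n; m/n*n≤m; m%n<n; m≥n⇒m/n>0)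
open import Data.Nat.Solver using (module +-*-Solver)
open import Data.Bool.Base using (Bool; true; false)
import Data.Bool.Properties as Bool
open import Data.Fin.Base using (Fin; zero; suc; inject≤; combine; punchOut)
open import Data.Fin.Properties
  using (any?; inject≤-injective; combine-injective; punchOut-injective; punchIn-punchOut)
  renaming (_≟_ to _≟ᶠ_; suc-injective to sucᶠ-injective; 0≢1+n to 0≢1+nᶠ)
open import Data.Fin.Subset using (Subset; _∈_; ∣_∣; _∩_; _-_; ⊤)
open import Data.Fin.Subset.Properties
  using (x∈p⇒∣p-x∣<∣p∣; x∈p∧x≢y⇒x∈p-y; x∈p∩q⁺; x∈p∩q⁻; ∣p∣≤n; ∣⊤∣≡n; ∩-identityʳ; ∩-idem)
open import Data.Vec.Base using ([]; _∷_; lookup; tabulate; here; there)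
open import Data.Vec.Properties using (lookup∘tabulate; []=⇒lookup; lookup⇒[]=; ≡-dec)
import Data.Vec.Functional as Vector
open import Data.Product using (∃-syntax; _×_; _,_; proj₁; proj₂)
open import Function.Base using (_∘_)
open import Function.Definitions using (Injective)
open import Relation.Binary.PropositionalEquality
open import Relation.Nullary using (yes; no; does; contradiction)
open import Relation.Nullary.Decidable using (dec-true)
open import Algebra.Properties.Semiring.Sum +-*-semiring
  using (sum; sum-syntax; ∑-comm; ∑-distrib-+; *-distribˡ-sum; *-distribʳ-sum; sum-cong-≗)

∣p∣≤∣q∣-byPartialInjection : ∀ {m n} {p : Subset m} {q : Subset n}
  (h : ∀ {x} → x ∈ p → Fin n) → (∀ {x} (x∈p : x ∈ p) → h x∈p ∈ q) →
  (∀ {x y} (x∈p : x ∈ p) (y∈p : y ∈ p) → h x∈p ≡ h y∈p → x ≡ y) →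
  ∣ p ∣ ≤ ∣ q ∣
∣p∣≤∣q∣-byPartialInjection {p = []} _ _ _ = z≤n
∣p∣≤∣q∣-byPartialInjection {p = false ∷ p} h h∈q h-inj =
  ∣p∣≤∣q∣-byPartialInjection (λ x∈p → h (there x∈p)) (λ x∈p → h∈q (there x∈p))
    (λ x∈p y∈p eq → sucᶠ-injective (h-inj (there x∈p) (there y∈p) eq))
∣p∣≤∣q∣-byPartialInjection {p = true ∷ p} {q} h h∈q h-inj = begin-strict
  ∣ p ∣           ≤⟨ ∣p∣≤∣q∣-byPartialInjection h⁺ h⁺∈q-h₀ h⁺-inj ⟩
  ∣ q - h here ∣  <⟨ x∈p⇒∣p-x∣<∣p∣ (h∈q here) ⟩
  ∣ q ∣           ∎
  where
  open ≤-Reasoning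
  h⁺ : ∀ {x} → x ∈ p → Fin _
  h⁺ x∈p = h (there x∈p)
  h⁺∈q-h₀ : ∀ {x} (x∈p : x ∈ p) → h⁺ x∈p ∈ q - h here
  h⁺∈q-h₀ x∈p = x∈p∧x≢y⇒x∈p-y (h∈q (there x∈p)) (λ eq → 0≢1+nᶠ (h-inj here (there x∈p) (sym eq)))
  h⁺-inj : ∀ {x y} (x∈p : x ∈ p) (y∈p : y ∈ p) → h⁺ x∈p ≡ h⁺ y∈p → x ≡ y
  h⁺-inj x∈p y∈p eq = sucᶠ-injective (h-inj (there x∈p) (there y∈p) eq)

∣p∣≤∣q∣-byInjection : ∀ {m n} {p : Subset m} {q : Subset n} (f : Fin m → Fin n) →
  Injective _≡_ _≡_ f → (∀ {x} → x ∈ p → f x ∈ q) → ∣ p ∣ ≤ ∣ q ∣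
∣p∣≤∣q∣-byInjection f f-inj f∈q = ∣p∣≤∣q∣-byPartialInjection (λ {x} _ → f x) f∈q (λ _ _ → f-inj)

∈-tabulate⁺ : ∀ {n} {f : Fin n → Bool} {x} → f x ≡ true → x ∈ tabulate f
∈-tabulate⁺ {f = f} {x} fx≡true = lookup⇒[]= x _ (trans (lookup∘tabulate f x) fx≡true)

∈-tabulate⁻ : ∀ {n} {f : Fin n → Bool} {x} → x ∈ tabulate f → f x ≡ true
∈-tabulate⁻ {f = f} {x} x∈ = trans (sym (lookup∘tabulate f x)) ([]=⇒lookup x∈)

preimage : ∀ {a n} → (Fin a → Fin n) → Subset n → Subset a
preimage f p = tabulate (λ y → lookup p (f y))

∈-preimage⁺ : ∀ {a n} {f : Fin a → Fin n} {p y} → f y ∈ p → y ∈ preimage f p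
∈-preimage⁺ fy∈p = ∈-tabulate⁺ ([]=⇒lookup fy∈p)

∈-preimage⁻ : ∀ {a n} {f : Fin a → Fin n} {p y} → y ∈ preimage f p → f y ∈ p
∈-preimage⁻ {p = p} y∈ = lookup⇒[]= _ p (∈-tabulate⁻ y∈)

image : ∀ {a n} → (Fin a → Fin n) → Subset n
image g = tabulate (λ z → does (any? (λ j → g j ≟ᶠ z)))

∈-image⁺ : ∀ {a n} {g : Fin a → Fin n} j → g j ∈ image g
∈-image⁺ {g = g} j = ∈-tabulate⁺ (dec-true (any? (λ i → g i ≟ᶠ g j)) (j , refl))

∈-image⁻ : ∀ {a n} {g : Fin a → Fin n} {z} → z ∈ image g → ∃[ j ] g j ≡ z
∈-image⁻ {g = g} {z} z∈
  with any? (λ j → g j ≟ᶠ z) | ∈-tabulate⁻ {f = λ z → does (any? (λ j → g j ≟ᶠ z))} z∈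
... | yes found | _  = found
... | no _      | ()

∣preimage∣≤∣p∣ : ∀ {a n} (f : Fin a → Fin n) (p : Subset n) → Injective _≡_ _≡_ f →
  ∣ preimage f p ∣ ≤ ∣ p ∣
∣preimage∣≤∣p∣ f p f-inj = ∣p∣≤∣q∣-byInjection f f-inj (∈-preimage⁻ {f = f} {p})

∣image∩p∣≤∣preimage∣ : ∀ {a n} (g : Fin a → Fin n) (p : Subset n) →
  ∣ image g ∩ p ∣ ≤ ∣ preimage g p ∣
∣image∩p∣≤∣preimage∣ g p =
  ∣p∣≤∣q∣-byPartialInjection preimagePoint preimagePoint∈ preimagePoint-injective
  where
  preimagePoint : ∀ {z} → z ∈ image g ∩ p → Fin _
  preimagePoint z∈ = proj₁ (∈-image⁻ {g = g} (proj₁ (x∈p∩q⁻ (image g) p z∈)))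
  g∘preimagePoint≡ : ∀ {z} (z∈ : z ∈ image g ∩ p) → g (preimagePoint z∈) ≡ z
  g∘preimagePoint≡ z∈ = proj₂ (∈-image⁻ {g = g} (proj₁ (x∈p∩q⁻ (image g) p z∈)))
  preimagePoint∈ : ∀ {z} (z∈ : z ∈ image g ∩ p) → preimagePoint z∈ ∈ preimage g p
  preimagePoint∈ z∈ =
    ∈-preimage⁺ (subst (_∈ p) (sym (g∘preimagePoint≡ z∈)) (proj₂ (x∈p∩q⁻ (image g) p z∈)))
  preimagePoint-injective : ∀ {z w} (z∈ : z ∈ image g ∩ p) (w∈ : w ∈ image g ∩ p) →
    preimagePoint z∈ ≡ preimagePoint w∈ → z ≡ w
  preimagePoint-injective z∈ w∈ eq =
    trans (sym (g∘preimagePoint≡ z∈)) (trans (cong g eq) (g∘preimagePoint≡ w∈))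

∣image∣≡ : ∀ {a n} (g : Fin a → Fin n) → Injective _≡_ _≡_ g → ∣ image g ∣ ≡ a
∣image∣≡ {a} g g-inj = ≤-antisym upper lower
  where
  open ≤-Reasoning
  upper : ∣ image g ∣ ≤ a
  upper = begin
    ∣ image g ∣           ≡⟨ cong ∣_∣ (∩-identityʳ (image g)) ⟨
    ∣ image g ∩ ⊤ ∣       ≤⟨ ∣image∩p∣≤∣preimage∣ g ⊤ ⟩
    ∣ preimage g ⊤ ∣      ≤⟨ ∣p∣≤n (preimage g ⊤) ⟩
    a                     ∎
  lower : a ≤ ∣ image g ∣
  lower = begin
    a                     ≡⟨ ∣⊤∣≡n a ⟨
    ∣ ⊤ {a} ∣             ≤⟨ ∣p∣≤∣q∣-byInjection {p = ⊤} g g-inj (λ {j} _ → ∈-image⁺ j) ⟩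
    ∣ image g ∣           ∎

𝟙 : Bool → ℕ
𝟙 true  = 1
𝟙 false = 0

∣p∣≡∑𝟙 : ∀ {n} (p : Subset n) → ∣ p ∣ ≡ ∑[ x < n ] 𝟙 (lookup p x)
∣p∣≡∑𝟙 []          = refl
∣p∣≡∑𝟙 (true ∷ p)  = cong suc (∣p∣≡∑𝟙 p)
∣p∣≡∑𝟙 (false ∷ p) = ∣p∣≡∑𝟙 p

∣preimage∣≡∑𝟙 : ∀ {a n} (f : Fin a → Fin n) (p : Subset n) →
  ∣ preimage f p ∣ ≡ ∑[ y < a ] 𝟙 (lookup p (f y))
∣preimage∣≡∑𝟙 f p = trans (∣p∣≡∑𝟙 (preimage f p))
  (sum-cong-≗ (λ y → cong 𝟙 (lookup∘tabulate (λ y → lookup p (f y)) y)))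

∑-mono-≤ : ∀ {n} {f g : Fin n → ℕ} → (∀ i → f i ≤ g i) → sum f ≤ sum g
∑-mono-≤ {zero}  _   = z≤n
∑-mono-≤ {suc n} f≤g = +-mono-≤ (f≤g zero) (∑-mono-≤ (f≤g ∘ suc))

∑-const : ∀ n c → ∑[ i < n ] c ≡ n * c
∑-const zero    c = refl
∑-const (suc n) c = cong (c +_) (∑-const n c)

f≤∑f : ∀ {n} (f : Fin n → ℕ) i → f i ≤ sum f
f≤∑f f zero    = m≤m+n (f zero) _
f≤∑f f (suc i) = ≤-trans (f≤∑f (f ∘ suc) i) (m≤n+m _ (f zero))

∑ᶠ : ∀ k q → ((Fin k → Fin q) → ℕ) → ℕ
∑ᶠ zero    q F = F (λ ())
∑ᶠ (suc k) q F = ∑[ y < q ] ∑ᶠ k q (λ x → F (y Vector.∷ x))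

∑ᶠ-mono-≤ : ∀ k q {F G : (Fin k → Fin q) → ℕ} → (∀ x → F x ≤ G x) → ∑ᶠ k q F ≤ ∑ᶠ k q G
∑ᶠ-mono-≤ zero    q F≤G = F≤G _
∑ᶠ-mono-≤ (suc k) q F≤G = ∑-mono-≤ (λ y → ∑ᶠ-mono-≤ k q (λ x → F≤G (y Vector.∷ x)))

∑ᶠ-1≡q^k : ∀ k q → ∑ᶠ k q (λ _ → 1) ≡ q ^ k
∑ᶠ-1≡q^k zero    q = refl
∑ᶠ-1≡q^k (suc k) q =
  trans (sum-cong-≗ {n = q} {y = λ _ → q ^ k} (λ _ → ∑ᶠ-1≡q^k k q)) (∑-const q (q ^ k))

∑ᶠ-distrib-+ : ∀ k q (F G : (Fin k → Fin q) → ℕ) →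
  ∑ᶠ k q (λ x → F x + G x) ≡ ∑ᶠ k q F + ∑ᶠ k q G
∑ᶠ-distrib-+ zero    q F G = refl
∑ᶠ-distrib-+ (suc k) q F G =
  trans (sum-cong-≗ (λ y → ∑ᶠ-distrib-+ k q (λ x → F (y Vector.∷ x)) (λ x → G (y Vector.∷ x))))
        (∑-distrib-+ (λ y → ∑ᶠ k q (λ x → F (y Vector.∷ x))) (λ y → ∑ᶠ k q (λ x → G (y Vector.∷ x))))

*-distribˡ-∑ᶠ : ∀ k q c (F : (Fin k → Fin q) → ℕ) → c * ∑ᶠ k q F ≡ ∑ᶠ k q (λ x → c * F x)
*-distribˡ-∑ᶠ zero    q c F = refl
*-distribˡ-∑ᶠ (suc k) q c F =
  trans (*-distribˡ-sum c (λ y → ∑ᶠ k q (λ x → F (y Vector.∷ x))))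
        (sum-cong-≗ (λ y → *-distribˡ-∑ᶠ k q c (λ x → F (y Vector.∷ x))))

∑ᶠ-∑-comm : ∀ k q m (F : Fin m → (Fin k → Fin q) → ℕ) →
  ∑ᶠ k q (λ x → ∑[ i < m ] F i x) ≡ ∑[ i < m ] ∑ᶠ k q (F i)
∑ᶠ-∑-comm zero    q m F = refl
∑ᶠ-∑-comm (suc k) q m F =
  trans (sum-cong-≗ (λ y → ∑ᶠ-∑-comm k q m (λ i x → F i (y Vector.∷ x))))
        (∑-comm (λ y i → ∑ᶠ k q (λ x → F i (y Vector.∷ x))))

𝟙[_≤_] : ℕ → ℕ → ℕ
𝟙[ zero  ≤ c     ] = 1
𝟙[ suc t ≤ zero  ] = 0
𝟙[ suc t ≤ suc c ] = 𝟙[ t ≤ c ]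

𝟙[≤]≡1 : ∀ {t c} → t ≤ c → 𝟙[ t ≤ c ] ≡ 1
𝟙[≤]≡1 z≤n       = refl
𝟙[≤]≡1 (s≤s t≤c) = 𝟙[≤]≡1 t≤c

𝟙[1+t≤b+c] : ∀ t b c → 𝟙[ suc t ≤ 𝟙 b + c ] ≤ 𝟙 b * 𝟙[ t ≤ c ] + 𝟙[ suc t ≤ c ]
𝟙[1+t≤b+c] t true  c = ≤-trans (m≤m+n 𝟙[ t ≤ c ] 0) (m≤m+n _ _)
𝟙[1+t≤b+c] t false c = ≤-refl

hits : ∀ {k q} → (Fin k → Fin q → Bool) → (Fin k → Fin q) → ℕ
hits {k} B x = ∑[ j < k ] 𝟙 (B j (x j))

#hitting : ∀ {k q} → ℕ → (Fin k → Fin q → Bool) → ℕ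
#hitting {k} {q} t B = ∑ᶠ k q (λ x → 𝟙[ t ≤ hits B x ])

-- Write x = y ∷ x′: a hit at y leaves one hit fewer to be found in x′.
#hitting-suc : ∀ {k q K} t (B : Fin (suc k) → Fin q → Bool) → ∑[ y < q ] 𝟙 (B zero y) ≤ K →
  #hitting (suc t) B ≤ K * #hitting t (B ∘ suc) + q * #hitting (suc t) (B ∘ suc)
#hitting-suc {k} {q} {K} t B row≤K = begin
  ∑[ y < q ] ∑ᶠ k q (λ x → 𝟙[ suc t ≤ 𝟙 (B zero y) + hits B′ x ])
    ≤⟨ ∑-mono-≤ (λ y → ∑ᶠ-mono-≤ k q (λ x → 𝟙[1+t≤b+c] t (B zero y) (hits B′ x))) ⟩
  ∑[ y < q ] ∑ᶠ k q (λ x → 𝟙 (B zero y) * 𝟙[ t ≤ hits B′ x ] + 𝟙[ suc t ≤ hits B′ x ])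
    ≡⟨ sum-cong-≗ (λ y → linear (𝟙 (B zero y))) ⟩
  ∑[ y < q ] (𝟙 (B zero y) * N + N⁺)
    ≡⟨ ∑-distrib-+ (λ y → 𝟙 (B zero y) * N) (λ _ → N⁺) ⟩
  ∑[ y < q ] (𝟙 (B zero y) * N) + ∑[ y < q ] N⁺
    ≡⟨ cong₂ _+_ (sym (*-distribʳ-sum N (λ y → 𝟙 (B zero y)))) (∑-const q N⁺) ⟩
  ∑[ y < q ] 𝟙 (B zero y) * N + q * N⁺
    ≤⟨ +-monoˡ-≤ (q * N⁺) (*-monoˡ-≤ N row≤K) ⟩
  K * N + q * N⁺ ∎
  where
  open ≤-Reasoning
  B′ = B ∘ suc
  N  = #hitting t B′
  N⁺ = #hitting (suc t) B′
  linear : ∀ b → ∑ᶠ k q (λ x → b * 𝟙[ t ≤ hits B′ x ] + 𝟙[ suc t ≤ hits B′ x ]) ≡ b * N + N⁺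
  linear b = trans (∑ᶠ-distrib-+ k q _ _) (cong (_+ N⁺) (sym (*-distribˡ-∑ᶠ k q b _)))

-- #hitting t B ≤ 2 ^ k K ^ t q ^ (k ∸ t), multiplied by q ^ t so that no subtraction occurs.
#hitting-bound : ∀ {q K} k t (B : Fin k → Fin q → Bool) → (∀ j → ∑[ y < q ] 𝟙 (B j y) ≤ K) →
  q ^ t * #hitting t B ≤ 2 ^ k * K ^ t * q ^ k
#hitting-bound {q} k zero B _ = begin
  1 * ∑ᶠ k q (λ _ → 1) ≡⟨ cong (1 *_) (∑ᶠ-1≡q^k k q) ⟩
  1 * q ^ k            ≤⟨ *-monoˡ-≤ (q ^ k) (subst (1 ≤_) (sym (*-identityʳ (2 ^ k))) (m^n>0 2 k)) ⟩
  2 ^ k * 1 * q ^ k    ∎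
  where open ≤-Reasoning
#hitting-bound {q} {K} zero (suc t) B _ = subst (_≤ 1 * K ^ suc t * 1) (sym (*-zeroʳ (q ^ suc t))) z≤n
#hitting-bound {q} {K} (suc k) (suc t) B row≤K = begin
  q ^ suc t * #hitting (suc t) B
    ≤⟨ *-monoʳ-≤ (q ^ suc t) (#hitting-suc t B (row≤K zero)) ⟩
  q ^ suc t * (K * N + q * N⁺)
    ≡⟨ solve 5 (λ q qᵗ K N N⁺ → (q :* qᵗ) :* (K :* N :+ q :* N⁺)
                 := q :* K :* (qᵗ :* N) :+ q :* ((q :* qᵗ) :* N⁺)) refl q (q ^ t) K N N⁺ ⟩
  q * K * (q ^ t * N) + q * (q ^ suc t * N⁺)
    ≤⟨ +-mono-≤ (*-monoʳ-≤ (q * K) (#hitting-bound k t (B ∘ suc) (row≤K ∘ suc)))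
                (*-monoʳ-≤ q (#hitting-bound k (suc t) (B ∘ suc) (row≤K ∘ suc))) ⟩
  q * K * (2 ^ k * K ^ t * q ^ k) + q * (2 ^ k * K ^ suc t * q ^ k)
    ≡⟨ solve 5 (λ q K a b c → q :* K :* (a :* b :* c) :+ q :* (a :* (K :* b) :* c)
                 := (con 2 :* a) :* (K :* b) :* (q :* c)) refl q K (2 ^ k) (K ^ t) (q ^ k) ⟩
  2 ^ suc k * K ^ suc t * q ^ suc k ∎
  where
  open ≤-Reasoning
  open +-*-Solver
  N  = #hitting t (B ∘ suc)
  N⁺ = #hitting (suc t) (B ∘ suc)

hittingFamily-bound : ∀ {k q K m} t ⦃ _ : NonZero q ⦄ (B : Fin m → Fin k → Fin q → Bool) →
  (∀ i j → ∑[ y < q ] 𝟙 (B i j y) ≤ K) → (∀ x → ∃[ i ] t ≤ hits (B i) x) →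
  q ^ t ≤ m * (2 ^ k * K ^ t)
hittingFamily-bound {k} {q} {K} {m} t B row≤K hit =
  *-cancelʳ-≤ (q ^ t) (m * (2 ^ k * K ^ t)) (q ^ k) ⦃ m^n≢0 q k ⦄ (begin
    q ^ t * q ^ k
      ≡⟨ cong (q ^ t *_) (∑ᶠ-1≡q^k k q) ⟨
    q ^ t * ∑ᶠ k q (λ _ → 1)
      ≤⟨ *-monoʳ-≤ (q ^ t) (∑ᶠ-mono-≤ k q covered) ⟩
    q ^ t * ∑ᶠ k q (λ x → ∑[ i < m ] 𝟙[ t ≤ hits (B i) x ])
      ≡⟨ cong (q ^ t *_) (∑ᶠ-∑-comm k q m (λ i x → 𝟙[ t ≤ hits (B i) x ])) ⟩
    q ^ t * ∑[ i < m ] #hitting t (B i)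
      ≡⟨ *-distribˡ-sum (q ^ t) (λ i → #hitting t (B i)) ⟩
    ∑[ i < m ] (q ^ t * #hitting t (B i))
      ≤⟨ ∑-mono-≤ (λ i → #hitting-bound k t (B i) (row≤K i)) ⟩
    ∑[ i < m ] (2 ^ k * K ^ t * q ^ k)
      ≡⟨ ∑-const m _ ⟩
    m * (2 ^ k * K ^ t * q ^ k)
      ≡⟨ *-assoc m (2 ^ k * K ^ t) (q ^ k) ⟨
    m * (2 ^ k * K ^ t) * q ^ k ∎)
  where
  open ≤-Reasoning
  covered : ∀ x → 1 ≤ ∑[ i < m ] 𝟙[ t ≤ hits (B i) x ]
  covered x with hit x
  ... | i , t≤hits = subst (_≤ _) (𝟙[≤]≡1 t≤hits) (f≤∑f (λ i → 𝟙[ t ≤ hits (B i) x ]) i)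

-- Block j is {vertex j y ∣ y : Fin q} inside the first k * q vertices; the last n % k are unused.
module Transversals (k n : ℕ) ⦃ _ : NonZero k ⦄ where

  q : ℕ
  q = n / k

  kq≤n : k * q ≤ n
  kq≤n = subst (_≤ n) (*-comm q k) (m/n*n≤m n k)

  vertex : Fin k → Fin q → Fin n
  vertex j y = inject≤ (combine j y) kq≤n

  vertex-injective : ∀ {j j′ y y′} → vertex j y ≡ vertex j′ y′ → j ≡ j′ × y ≡ y′
  vertex-injective eq = combine-injective _ _ _ _ (inject≤-injective kq≤n kq≤n _ _ eq)

  transversal : (Fin k → Fin q) → Subset n
  transversal x = image (λ j → vertex j (x j))

  ∣transversal∣≡k : ∀ x → ∣ transversal x ∣ ≡ k
  ∣transversal∣≡k x = ∣image∣≡ (λ j → vertex j (x j)) (proj₁ ∘ vertex-injective)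

  trace : Subset n → Fin k → Fin q → Bool
  trace p j y = lookup p (vertex j y)

  ∑trace≤∣p∣ : ∀ p j → ∑[ y < q ] 𝟙 (trace p j y) ≤ ∣ p ∣
  ∑trace≤∣p∣ p j = subst (_≤ ∣ p ∣) (∣preimage∣≡∑𝟙 (vertex j) p)
    (∣preimage∣≤∣p∣ (vertex j) p (proj₂ ∘ vertex-injective))

  ∣transversal∩p∣≤hits : ∀ x p → ∣ transversal x ∩ p ∣ ≤ hits (trace p) x
  ∣transversal∩p∣≤hits x p = subst (∣ transversal x ∩ p ∣ ≤_)
    (∣preimage∣≡∑𝟙 (λ j → vertex j (x j)) p) (∣image∩p∣≤∣preimage∣ (λ j → vertex j (x j)) p)

  q≢0 : k ≤ n → NonZero q
  q≢0 k≤n = >-nonZero (m≥n⇒m/n>0 k≤n)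

  n≤2kq : k ≤ n → n ≤ 2 * k * q
  n≤2kq k≤n = begin
    n               ≡⟨ m≡m%n+[m/n]*n n k ⟩
    n % k + q * k   ≤⟨ +-monoˡ-≤ (q * k) (≤-trans (<⇒≤ (m%n<n n k)) (m≤m*n k q ⦃ q≢0 k≤n ⦄)) ⟩
    k * q + q * k   ≡⟨ solve 2 (λ k q → k :* q :+ q :* k := con 2 :* k :* q) refl k q ⟩
    2 * k * q       ∎
    where
    open ≤-Reasoning
    open +-*-Solver

^-distribʳ-* : ∀ a b t → (a * b) ^ t ≡ a ^ t * b ^ t
^-distribʳ-* a b zero    = refl
^-distribʳ-* a b (suc t) = begin
  a * b * (a * b) ^ t      ≡⟨ cong (a * b *_) (^-distribʳ-* a b t) ⟩
  a * b * (a ^ t * b ^ t)  ≡⟨ solve 4 (λ a b x y → a :* b :* (x :* y) := a :* x :* (b :* y))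
                                      refl a b (a ^ t) (b ^ t) ⟩
  a * a ^ t * (b * b ^ t)  ∎
  where
  open ≡-Reasoning
  open +-*-Solver

meetingFamily-bound : ∀ {n m K} k t ⦃ _ : NonZero k ⦄ (E : Fin m → Subset n) →
  (∀ i → ∣ E i ∣ ≤ K) → k ≤ n → (∀ S → ∣ S ∣ ≡ k → ∃[ i ] t ≤ ∣ S ∩ E i ∣) →
  n ^ t ≤ (2 * k) ^ t * (2 ^ k * K ^ t) * m
meetingFamily-bound {n} {m} {K} k t E ∣E∣≤K k≤n meets = begin
  n ^ t                      ≤⟨ ^-monoˡ-≤ t (n≤2kq k≤n) ⟩
  (2 * k * q) ^ t            ≡⟨ ^-distribʳ-* (2 * k) q t ⟩
  (2 * k) ^ t * q ^ t        ≤⟨ *-monoʳ-≤ ((2 * k) ^ t) q^t≤mC ⟩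
  (2 * k) ^ t * (m * C)      ≡⟨ cong ((2 * k) ^ t *_) (*-comm m C) ⟩
  (2 * k) ^ t * (C * m)      ≡⟨ *-assoc ((2 * k) ^ t) C m ⟨
  (2 * k) ^ t * C * m        ∎
  where
  open ≤-Reasoning
  open Transversals k n
  C = 2 ^ k * K ^ t
  hit : ∀ x → ∃[ i ] t ≤ hits (trace (E i)) x
  hit x with meets (transversal x) (∣transversal∣≡k x)
  ... | i , t≤∣S∩Eᵢ∣ = i , ≤-trans t≤∣S∩Eᵢ∣ (∣transversal∩p∣≤hits x (E i))
  q^t≤mC : q ^ t ≤ m * C
  q^t≤mC = hittingFamily-bound t ⦃ q≢0 k≤n ⦄ (trace ∘ E)
    (λ i j → ≤-trans (∑trace≤∣p∣ (E i) j) (∣E∣≤K i)) hit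

Berge-overlap : ∀ {v a n m} {G : Fin a → Subset v} {H : Fin m → Subset n}
  (f : Fin v → Fin n) (φ : Fin a → Fin m) → Injective _≡_ _≡_ f →
  (∀ e x → x ∈ G e → f x ∈ H (φ e)) →
  ∀ e e′ → ∣ G e ∩ G e′ ∣ ≤ ∣ H (φ e) ∩ H (φ e′) ∣
Berge-overlap {G = G} f φ f-inj covers e e′ = ∣p∣≤∣q∣-byInjection f f-inj f∈
  where
  f∈ : ∀ {x} → x ∈ G e ∩ G e′ → f x ∈ _
  f∈ x∈ with x∈p∩q⁻ (G e) (G e′) x∈
  ... | x∈Gₑ , x∈Gₑ′ = x∈p∩q⁺ (covers e _ x∈Gₑ , covers e′ _ x∈Gₑ′)

Berge-addEdge-avoiding : ∀ {v a n m} {G : Fin a → Subset v} {E : Fin m → Subset n} {S}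
  (f : Fin v → Fin n) (φ : Fin a → Fin (suc m)) → Injective _≡_ _≡_ f → Injective _≡_ _≡_ φ →
  (∀ e x → x ∈ G e → f x ∈ addEdge E S (φ e)) → (∀ e → zero ≢ φ e) →
  ContainsBerge G E
Berge-addEdge-avoiding {G = G} {E} {S} f φ f-inj φ-inj covers avoids =
  f , φ′ , f-inj , φ′-inj , covers′
  where
  φ′ : _ → Fin _
  φ′ e = punchOut (avoids e)
  φ′-inj : Injective _≡_ _≡_ φ′
  φ′-inj eq = φ-inj (punchOut-injective (avoids _) (avoids _) eq)
  covers′ : ∀ e x → x ∈ G e → f x ∈ E (φ′ e)
  covers′ e x x∈ =
    subst (λ i → f x ∈ addEdge E S i) (sym (punchIn-punchOut (avoids e))) (covers e x x∈)

saturated⇒kSetsMeetEdges : ∀ {v a n m} k t (G : Fin a → Subset v) (E : Fin m → Subset n) →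
  (∀ e → ∃[ e′ ] (e′ ≢ e × t ≤ ∣ G e ∩ G e′ ∣)) → t ≤ k → BergeSaturated k G E →
  ∀ S → ∣ S ∣ ≡ k → ∃[ i ] t ≤ ∣ S ∩ E i ∣
saturated⇒kSetsMeetEdges k t G E overlapping t≤k (noBerge , saturated) S ∣S∣≡k
  with any? (λ i → ≡-dec Bool._≟_ (E i) S)
... | yes (i , Eᵢ≡S) = i , ≤-trans t≤k (≤-reflexive (sym ∣S∩Eᵢ∣≡k))
  where
  ∣S∩Eᵢ∣≡k : ∣ S ∩ E i ∣ ≡ k
  ∣S∩Eᵢ∣≡k = trans (cong (λ p → ∣ S ∩ p ∣) Eᵢ≡S) (trans (cong ∣_∣ (∩-idem S)) ∣S∣≡k)
... | no S∉E with saturated S ∣S∣≡k (λ i Eᵢ≡S → S∉E (i , Eᵢ≡S))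
... | f , φ , f-inj , φ-inj , covers with any? (λ e → zero ≟ᶠ φ e)
...   | no avoids =
  contradiction (Berge-addEdge-avoiding f φ f-inj φ-inj covers (λ e 0≡φe → avoids (e , 0≡φe))) noBerge
...   | yes (e , 0≡φe) with overlapping e
...     | e′ , e′≢e , t≤∣Gₑ∩Gₑ′∣ = punchOut 0≢φe′ , ≤-trans t≤∣Gₑ∩Gₑ′∣ ∣Gₑ∩Gₑ′∣≤∣S∩Eᵢ∣
  where
  0≢φe′ : zero ≢ φ e′
  0≢φe′ 0≡φe′ = e′≢e (φ-inj (trans (sym 0≡φe′) 0≡φe))
  ∣Gₑ∩Gₑ′∣≤∣S∩Eᵢ∣ : ∣ G e ∩ G e′ ∣ ≤ ∣ S ∩ E (punchOut 0≢φe′) ∣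
  ∣Gₑ∩Gₑ′∣≤∣S∩Eᵢ∣ = subst₂ (λ i i′ → ∣ G e ∩ G e′ ∣ ≤ ∣ addEdge E S i ∩ addEdge E S i′ ∣)
    (sym 0≡φe) (sym (punchIn-punchOut 0≢φe′)) (Berge-overlap {H = addEdge E S} f φ f-inj covers e e′)

-- From r < k only k ≢ 0 is used.
mainTheorem10 : (r t k v a : ℕ) (G : Fin a → Subset v) →
    Injective _≡_ _≡_ G → Uniform r G →
    (∀ i → ∃[ j ] (j ≢ i × t ≤ ∣ G i ∩ G j ∣)) →
    t ≤ k → r < k →
    ∃[ d ] ∃[ N ] (∀ n → N ≤ n → ∀ m (E : Fin m → Subset n) →
      Injective _≡_ _≡_ E → Uniform k E → BergeSaturated k G E →
      n ^ t ≤ d * m)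
mainTheorem10 r t zero v a G _ _ _ _ ()
mainTheorem10 r t k@(suc _) v a G _ _ overlapping t≤k _ =
  (2 * k) ^ t * (2 ^ k * k ^ t) , k , λ n k≤n m E _ uniform saturated →
    meetingFamily-bound k t E (≤-reflexive ∘ uniform) k≤n
      (saturated⇒kSetsMeetEdges k t G E overlapping t≤k saturated)
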